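{- Let $A$ be a premetric space and $B$ a Cauchy complete premetric space, and let $L : \mathbb{Q}^+$. If $s$ is a Cauchy approximation in the premetric space $A \to B$ such that for every $\varepsilon : \mathbb{Q}^+$ the function $s_\varepsilon : A \to B$ is Lipschitz with constant $L$, then the limit $\lim s : A \to B$ is Lipschitz with constant $L$.
   Context: Work in homotopy type theory with univalence; $\exists$ is propositionally truncated. $\mathbb{Q}^+$ denotes the positive rationals. A premetric space is a type with a family of mere propositions $x \approx_\varepsilon y$ ($\varepsilon : \mathbb{Q}^+$) satisfying reflexivity, symmetry, separatedness (if $x \approx_\varepsilon y$ for all $\varepsilon$ then $x=y$), triangularity ($x \approx_\varepsilon y$, $y \approx_\delta z$ imply $x \approx_{\varepsilon+\delta} z$), and roundedness ($x \approx_\varepsilon y \leftrightarrow \exists \delta<\varepsilon, x \approx_\delta y$). A Cauchy approximation is $x : \mathbb{Q}^+ \to B$ with $x_\varepsilon \approx_{\varepsilon+\delta} x_\delta$ for all $\varepsilon,\delta$; $l$ is a limit of $x$ if $x_\varepsilon \approx_{\varepsilon+\delta} l$ for all $\varepsilon,\delta$; $B$ is Cauchy complete if every Cauchy approximation has a (unique) limit. A function $f$ is Lipschitz with constant $L$ if $x \approx_\varepsilon y$ implies $f x \approx_{L\varepsilon} f y$. The function type $A \to B$ is a premetric space with $f \approx_\varepsilon g :\equiv \exists \delta<\varepsilon, \forall x, f x \approx_\delta g x$; it is Cauchy complete when $B$ is, with $\lim s = \lambda y.\,\lim(\lambda \varepsilon.\, s_\varepsilon\, y)$. -}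

module Defs where

open import Level using (Level; suc; _⊔_)
open import Data.Rational using (ℚ; Positive) renaming (_+_ to _+ℚ_; _*_ to _*ℚ_; _<_ to _<ℚ_)
open import Data.Rational.Properties using (pos+pos⇒pos; pos*pos⇒pos)
open import Data.Product using (Σ; Σ-syntax; _×_; _,_; proj₁; proj₂)
open import Relation.Binary.PropositionalEquality using (_≡_)

isProp : ∀ {ℓ} → Set ℓ → Set ℓ
isProp P = (a b : P) → a ≡ b

-- ∥ A ∥ : the propositional truncation, encoded impredicatively over
-- propositions in Set (the universe where all closeness relations live).
∥_∥ : Set → Set₁
∥ A ∥ = (P : Set) → isProp P → (A → P) → P

∣_∣ : {A : Set} → A → ∥ A ∥
∣ a ∣ = λ P _ f → f a

∃∥ : (A : Set) → (A → Set) → Set₁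
∃∥ A P = ∥ Σ A P ∥

record ℚ⁺ : Set where
  constructor mkℚ⁺
  field
    val : ℚ
    .{{pos}} : Positive val
open ℚ⁺ public

_+⁺_ : ℚ⁺ → ℚ⁺ → ℚ⁺
(mkℚ⁺ p) +⁺ (mkℚ⁺ q) = mkℚ⁺ (p +ℚ q) {{pos+pos⇒pos p q}}

_*⁺_ : ℚ⁺ → ℚ⁺ → ℚ⁺
(mkℚ⁺ p) *⁺ (mkℚ⁺ q) = mkℚ⁺ (p *ℚ q) {{pos*pos⇒pos p q}}

_<⁺_ : ℚ⁺ → ℚ⁺ → Set
ε <⁺ δ = val ε <ℚ val δ

infixl 6 _+⁺_
infixl 7 _*⁺_
infix 4 _<⁺_

record IsPremetric (X : Set) (_≈[_]_ : X → ℚ⁺ → X → Set) : Set₁ where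
  field
    ≈-prop   : ∀ x ε y → isProp (x ≈[ ε ] y)
    ≈-refl   : ∀ x ε → x ≈[ ε ] x
    ≈-sym    : ∀ x y ε → x ≈[ ε ] y → y ≈[ ε ] x
    ≈-sep    : ∀ x y → (∀ ε → x ≈[ ε ] y) → x ≡ y
    ≈-triang : ∀ x y z ε δ → x ≈[ ε ] y → y ≈[ δ ] z → x ≈[ ε +⁺ δ ] z
    ≈-round⇒ : ∀ x y ε → x ≈[ ε ] y → ∃∥ ℚ⁺ (λ δ → δ <⁺ ε × x ≈[ δ ] y)
    ≈-round⇐ : ∀ x y ε → ∃∥ ℚ⁺ (λ δ → δ <⁺ ε × x ≈[ δ ] y) → x ≈[ ε ] y

record Premetric : Set₁ where
  field
    Carrier : Set
    _≈[_]_  : Carrier → ℚ⁺ → Carrier → Set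
    isPremetric : IsPremetric Carrier _≈[_]_
  open IsPremetric isPremetric public

module _ (B : Premetric) where
  open Premetric B

  IsCauchyApprox : (ℚ⁺ → Carrier) → Set
  IsCauchyApprox x = ∀ ε δ → x ε ≈[ ε +⁺ δ ] x δ

  CauchyApprox : Set
  CauchyApprox = Σ (ℚ⁺ → Carrier) IsCauchyApprox

  IsLimit : (ℚ⁺ → Carrier) → Carrier → Set
  IsLimit x l = ∀ ε δ → x ε ≈[ ε +⁺ δ ] l

  -- Cauchy completeness: every Cauchy approximation has a limit
  -- (limits are automatically unique by separatedness).
  record CauchyComplete : Set where
    field
      lim    : CauchyApprox → Carrier
      lim-is : (x : CauchyApprox) → IsLimit (proj₁ x) (lim x)

open CauchyComplete public

Lipschitz : (A B : Premetric) → (Premetric.Carrier A → Premetric.Carrier B) → ℚ⁺ → Set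
Lipschitz A B f L =
  ∀ x y ε → Premetric._≈[_]_ A x ε y → Premetric._≈[_]_ B (f x) (L *⁺ ε) (f y)

-- The premetric on the function type A → B (only the closeness relation
-- and the notions of Cauchy approximation / limit are needed):
--   f ≈ε g  :≡  ∃ δ < ε, ∀ x, f x ≈δ g x

module FunSpace (A B : Premetric) where
  private
    module A = Premetric A
    module B = Premetric B

  Fun : Set
  Fun = A.Carrier → B.Carrier

  _≈→[_]_ : Fun → ℚ⁺ → Fun → Set₁
  f ≈→[ ε ] g = ∃∥ ℚ⁺ (λ δ → δ <⁺ ε × (∀ x → f x B.≈[ δ ] g x))

  IsCauchyApprox→ : (ℚ⁺ → Fun) → Set₁
  IsCauchyApprox→ s = ∀ ε δ → s ε ≈→[ ε +⁺ δ ] s δ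

  pointwise : (s : ℚ⁺ → Fun) → IsCauchyApprox→ s → (y : A.Carrier)
            → CauchyApprox B
  pointwise s c y =
    (λ ε → s ε y) ,
    (λ ε δ → c ε δ (s ε y B.≈[ ε +⁺ δ ] s δ y) (B.≈-prop _ _ _)
               (λ { (η , η< , h) →
                   B.≈-round⇐ _ _ _ (∣ η , η< , h y ∣) }))

  lim→ : CauchyComplete B → (s : ℚ⁺ → Fun) → IsCauchyApprox→ s → Fun
  lim→ cB s c y = lim cB (pointwise s c y)

-- Round x ≈ε y down to x ≈δ y with δ < ε and pick η with 4η < L(ε − δ). Then
-- lim s x ≈₂η s_η x ≈_{Lδ} s_η y ≈₂η lim s y, and Lδ + 4η < Lε, so rounding
-- up again gives lim s x ≈_{Lε} lim s y.
module Submission where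

open import Defs
open import Data.Product using (Σ; _,_; _×_)
open import Data.Rational using (ℚ; Positive; positive; _+_; _-_; -_; _*_; _<_; ½)
import Data.Rational.Properties as ℚ
open import Data.Rational.Solver using (module +-*-Solver)
open import Relation.Binary.PropositionalEquality using (_≡_; refl; sym; subst)

p<q⇒positive[q-p] : ∀ {p q} → p < q → Positive (q - p)
p<q⇒positive[q-p] {p} {q} p<q =
  positive (subst (_< q - p) (ℚ.+-inverseʳ p) (ℚ.+-monoˡ-< (- p) p<q))

p-q<p : ∀ p q → .{{Positive q}} → p - q < p
p-q<p p q = subst (p - q <_) (ℚ.+-identityʳ p)
  (ℚ.+-monoʳ-< p (ℚ.neg-antimono-< (ℚ.positive⁻¹ q)))

*⁺-monoʳ-< : ∀ L δ ε → δ <⁺ ε → L *⁺ δ <⁺ L *⁺ ε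
*⁺-monoʳ-< (mkℚ⁺ l) _ _ = ℚ.*-monoʳ-<-pos l

<⁺-gap : ∀ δ ε → δ <⁺ ε → Σ ℚ⁺ λ η → (η +⁺ η) +⁺ δ +⁺ (η +⁺ η) <⁺ ε
<⁺-gap δ ε δ<ε = η , subst (_< val ε) (sym (four-η+δ≡ε-t/2 (val ε) (val δ))) ε-t/2<ε
  where
  t = val ε - val δ
  instance t-pos : Positive t
  t-pos = p<q⇒positive[q-p] δ<ε

  η : ℚ⁺
  η = mkℚ⁺ (t * (½ * ½ * ½)) {{ℚ.pos*pos⇒pos t (½ * ½ * ½)}}

  four-η+δ≡ε-t/2 : ∀ e d → let h = (e - d) * (½ * ½ * ½)
                   in (h + h) + d + (h + h) ≡ e - (e - d) * ½
  four-η+δ≡ε-t/2 = solve 2 (λ e d → eighth e d :+ eighth e d :+ d :+ (eighth e d :+ eighth e d)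
                                    := e :- (e :- d) :* con ½) refl
    where
    open +-*-Solver
    eighth : ∀ {n} → Polynomial n → Polynomial n → Polynomial n
    eighth e d = (e :- d) :* con (½ * ½ * ½)

  ε-t/2<ε : val ε - t * ½ < val ε
  ε-t/2<ε = p-q<p (val ε) (t * ½) {{ℚ.pos*pos⇒pos t ½}}

module _ (X : Premetric) where
  open Premetric X

  ≈-weaken : ∀ {x y} δ ε → δ <⁺ ε → x ≈[ δ ] y → x ≈[ ε ] y
  ≈-weaken δ ε δ<ε x≈y = ≈-round⇐ _ _ _ ∣ _ , δ<ε , x≈y ∣

  limits-close : ∀ {u v l m} η δ → IsLimit X u l → IsLimit X v m → u η ≈[ δ ] v η
               → l ≈[ (η +⁺ η) +⁺ δ +⁺ (η +⁺ η) ] m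
  limits-close η δ u→l v→m uη≈vη =
    ≈-triang _ _ _ _ _ (≈-triang _ _ _ _ _ (≈-sym _ _ _ (u→l η η)) uη≈vη) (v→m η η)

lemma2p17 : (A B : Premetric) (cB : CauchyComplete B) (L : ℚ⁺)
    → (s : ℚ⁺ → FunSpace.Fun A B) (c : FunSpace.IsCauchyApprox→ A B s)
    → (∀ ε → Lipschitz A B (s ε) L)
    → Lipschitz A B (FunSpace.lim→ A B cB s c) L
lemma2p17 A B cB L s c lip x y ε x≈εy =
  A.≈-round⇒ x y ε x≈εy _ (B.≈-prop _ _ _) from-rounded
  where
  module A = Premetric A
  module B = Premetric B
  open FunSpace A B

  from-rounded : Σ ℚ⁺ (λ δ → δ <⁺ ε × x A.≈[ δ ] y)
               → lim→ cB s c x B.≈[ L *⁺ ε ] lim→ cB s c y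
  from-rounded (δ , δ<ε , x≈δy) = close (<⁺-gap (L *⁺ δ) (L *⁺ ε) (*⁺-monoʳ-< L δ ε δ<ε))
    where
    close : Σ ℚ⁺ (λ η → (η +⁺ η) +⁺ L *⁺ δ +⁺ (η +⁺ η) <⁺ L *⁺ ε)
          → lim→ cB s c x B.≈[ L *⁺ ε ] lim→ cB s c y
    close (η , γ<Lε) = ≈-weaken B ((η +⁺ η) +⁺ L *⁺ δ +⁺ (η +⁺ η)) (L *⁺ ε) γ<Lε
      (limits-close B η (L *⁺ δ) (lim-is cB (pointwise s c x)) (lim-is cB (pointwise s c y))
        (lip η x y δ x≈δy))
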